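{- Let $W_n$ be the wheel on $n>3$ vertices (so it has $m=2n-2$ edges), and let $1\le k\le 2n-2$ be an integer. Then \[ \phi_k(W_n)=\begin{cases}0 & \text{if } 2n-4\le k\le 2n-3,\\ 1 & \text{if } k=2n-2,\\ 2 & \text{if } \lfloor n/2\rfloor\le k\le 2n-5,\\ 3 & \text{if } 1\le k<\lfloor n/2\rfloor.\end{cases} \]
   Context: The wheel $W_n$ on $n$ vertices consists of a cycle on $n-1$ vertices together with a center vertex adjacent to every cycle vertex. For a graph $G$ and a vertex coloring $c:V(G)\to\{1,\dots,\ell\}$ (not required to be proper or surjective), an edge $uv$ is called bad if $c(u)=c(v)$. For an integer $k\ge 0$, the $k$-defect number $\phi_k(G)$ is the smallest positive integer $\ell$ such that there is a coloring $c:V(G)\to\{1,\dots,\ell\}$ with exactly $k$ bad edges; if no coloring (with any number of colors) has exactly $k$ bad edges, then $\phi_k(G)=0$ by convention. -}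

module Defs where

open import Data.Nat using (ℕ; zero; suc; _≤_; _<_)
open import Data.Nat.DivMod using (_%_; m%n<n)
open import Data.Fin using (Fin; zero; suc; toℕ; fromℕ<; _≟_)
open import Data.List using (List; []; _∷_; _++_; map; length; filter; allFin)
open import Data.Product using (_×_; _,_; ∃)
open import Relation.Nullary using (¬_)
open import Relation.Binary.PropositionalEquality using (_≡_)

record Graph : Set where
  field
    vertices : ℕ
    edges    : List (Fin vertices × Fin vertices)
open Graph public

next : ∀ {r} → Fin r → Fin r
next {suc r} i = fromℕ< (m%n<n (suc (toℕ i)) (suc r))

-- Wheel on n vertices: vertex zero is the center, vertices suc i (i : Fin r)
-- form the cycle of length r = n - 1 (suc i adjacent to suc (next i)).
wheel : ℕ → Graph
wheel zero    = record { vertices = zero ; edges = [] }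
wheel (suc r) = record
  { vertices = suc r
  ; edges    = map (λ i → (zero , suc i)) (allFin r)
            ++ map (λ i → (suc i , suc (next i))) (allFin r)
  }

badCount : (G : Graph) {ℓ : ℕ} → (Fin (vertices G) → Fin ℓ) → ℕ
badCount G c = length (filter (λ e → c (Data.Product.proj₁ e) ≟ c (Data.Product.proj₂ e)) (edges G))

HasDefect : Graph → ℕ → ℕ → Set
HasDefect G ℓ k = ∃ λ (c : Fin (vertices G) → Fin ℓ) → badCount G c ≡ k

-- PhiIs G k v  means  φ_k(G) = v  (with the convention φ_k(G) = 0 if no
-- coloring with any number of colors has exactly k bad edges)
PhiIs : Graph → ℕ → ℕ → Set
PhiIs G k zero    = ∀ ℓ → ¬ HasDefect G ℓ k
PhiIs G k (suc v) = HasDefect G (suc v) k × (∀ ℓ → 1 ≤ ℓ → ℓ < suc v → ¬ HasDefect G ℓ k)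

-- Write r = n - 1 for the rim length and colour the centre z.  The bad edges are the T rim
-- vertices coloured z plus the M monochromatic rim edges.  Call a rim edge crossing when exactly
-- one end is coloured z: no edge is both monochromatic and crossing, so M + X ≤ r, and on a
-- closed walk the number X of crossings is even, since 2T + X counts twice the rim edges
-- touching z.  Unless every rim vertex is coloured z (giving 2r bad edges), either X = 0, which
-- forces T = 0 and at most r ≤ 2r - 3 bad edges, or X ≥ 2, giving T ≤ r - 1 and M ≤ r - 2.  With
-- at most two colours every good rim edge has an end coloured z, so r ≤ M + 2T ≤ 2k.  The
-- remaining values are realised by explicit rims: blocks of one colour followed by an alternating
-- stretch, closed with a vertex of the centre colour when the parity of r demands it.
module Submission where

open import Defs
open import Data.Nat using (ℕ; zero; suc; _+_; _*_; _∸_; _⊔_; _≤_; _<_; z≤n; s≤s; s≤s⁻¹)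
open import Data.Nat.Properties
open import Data.Nat.DivMod using (_/_; _%_; m%n<n; m<n⇒m%n≡m; n%n≡0; m≡m%n+[m/n]*n)
open import Data.Nat.Solver using (module +-*-Solver)
open import Data.Fin using (Fin; zero; suc; toℕ; fromℕ; inject₁)
import Data.Fin as Fin
open import Data.Fin.Patterns using (0F; 1F; 2F)
open import Data.Fin.Properties using (toℕ-injective; toℕ-fromℕ<; toℕ-inject₁; toℕ-fromℕ; toℕ<n)
open import Data.List using (List; []; _∷_; _++_; _∷ʳ_; map; length; filter; allFin; tabulate; lookup; replicate)
open import Data.List.Properties using (tabulate-cong; tabulate-lookup; map-tabulate; length-tabulate; length-++; length-replicate; ++-assoc)
open import Data.List.Relation.Unary.All as All using (All; []; _∷_)
open import Data.List.Relation.Unary.All.Properties using (++⁻ˡ)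
open import Data.Product using (_×_; _,_)
open import Data.Sum using (_⊎_; inj₁; inj₂)
open import Data.Empty using (⊥-elim)
open import Function using (_∘_; id)
open import Relation.Nullary using (¬_; Dec; yes; no)
open import Relation.Unary using (Decidable)
open import Relation.Binary.Definitions using (DecidableEquality)
open import Relation.Binary.PropositionalEquality
open import Algebra.Properties.CommutativeSemigroup +-commutativeSemigroup
  using () renaming (interchange to +-interchange)
open +-*-Solver using (solve; _:=_; _:+_; _:*_; con)

χ : {P : Set} → Dec P → ℕ
χ (yes _) = 1
χ (no _)  = 0

χ≤1 : {P : Set} (d : Dec P) → χ d ≤ 1
χ≤1 (yes _) = ≤-refl
χ≤1 (no _)  = z≤n

χ-yes : {P : Set} → P → (d : Dec P) → χ d ≡ 1
χ-yes _ (yes _) = refl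
χ-yes p (no ¬p) = ⊥-elim (¬p p)

χ-no : {P : Set} → ¬ P → (d : Dec P) → χ d ≡ 0
χ-no ¬p (yes p) = ⊥-elim (¬p p)
χ-no _  (no _)  = refl

∑ : {A : Set} → (A → ℕ) → List A → ℕ
∑ f []       = 0
∑ f (x ∷ xs) = f x + ∑ f xs

module _ {A : Set} where

  length-filter≡∑χ : {P : A → Set} (P? : Decidable P) (xs : List A) →
                     length (filter P? xs) ≡ ∑ (χ ∘ P?) xs
  length-filter≡∑χ P? []       = refl
  length-filter≡∑χ P? (x ∷ xs) with P? x
  ... | yes _ = cong suc (length-filter≡∑χ P? xs)
  ... | no _  = length-filter≡∑χ P? xs

  ∑-++ : (f : A → ℕ) (xs ys : List A) → ∑ f (xs ++ ys) ≡ ∑ f xs + ∑ f ys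
  ∑-++ f []       ys = refl
  ∑-++ f (x ∷ xs) ys = trans (cong (f x +_) (∑-++ f xs ys)) (sym (+-assoc (f x) _ _))

  ∑-map : {B : Set} (f : B → ℕ) (g : A → B) (xs : List A) → ∑ f (map g xs) ≡ ∑ (f ∘ g) xs
  ∑-map f g []       = refl
  ∑-map f g (x ∷ xs) = cong (f (g x) +_) (∑-map f g xs)

  ∑-cong : {f g : A → ℕ} → (∀ x → f x ≡ g x) → (xs : List A) → ∑ f xs ≡ ∑ g xs
  ∑-cong f≗g []       = refl
  ∑-cong f≗g (x ∷ xs) = cong₂ _+_ (f≗g x) (∑-cong f≗g xs)

  ∑-+ : (f g : A → ℕ) (xs : List A) → ∑ (λ x → f x + g x) xs ≡ ∑ f xs + ∑ g xs
  ∑-+ f g []       = refl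
  ∑-+ f g (x ∷ xs) = trans (cong (f x + g x +_) (∑-+ f g xs)) (+-interchange (f x) (g x) (∑ f xs) (∑ g xs))

  ∑-*ˡ : (k : ℕ) (f : A → ℕ) (xs : List A) → ∑ (λ x → k * f x) xs ≡ k * ∑ f xs
  ∑-*ˡ k f []       = sym (*-zeroʳ k)
  ∑-*ˡ k f (x ∷ xs) = trans (cong (k * f x +_) (∑-*ˡ k f xs)) (sym (*-distribˡ-+ k (f x) (∑ f xs)))

  ∑-mono-≤ : {f g : A → ℕ} → (∀ x → f x ≤ g x) → (xs : List A) → ∑ f xs ≤ ∑ g xs
  ∑-mono-≤ f≤g []       = z≤n
  ∑-mono-≤ f≤g (x ∷ xs) = +-mono-≤ (f≤g x) (∑-mono-≤ f≤g xs)

  ∑-one : (xs : List A) → ∑ (λ _ → 1) xs ≡ length xs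
  ∑-one []       = refl
  ∑-one (x ∷ xs) = cong suc (∑-one xs)

  ∑≤length : {f : A → ℕ} → (∀ x → f x ≤ 1) → (xs : List A) → ∑ f xs ≤ length xs
  ∑≤length f≤1 xs = ≤-trans (∑-mono-≤ f≤1 xs) (≤-reflexive (∑-one xs))

  ∑-All : {f : A → ℕ} {c : ℕ} {xs : List A} → All (λ x → f x ≡ c) xs → ∑ f xs ≡ length xs * c
  ∑-All []         = refl
  ∑-All (fx≡c ∷ p) = cong₂ _+_ fx≡c (∑-All p)

  ∑-replicate : (f : A → ℕ) (m : ℕ) (x : A) → ∑ f (replicate m x) ≡ m * f x
  ∑-replicate f zero    x = refl
  ∑-replicate f (suc m) x = cong (f x +_) (∑-replicate f m x)

pathEdges : {A : Set} → A → List A → List (A × A)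
pathEdges a []       = []
pathEdges a (x ∷ xs) = (a , x) ∷ pathEdges x xs

cycleEdges : {A : Set} → A → List A → List (A × A)
cycleEdges y t = pathEdges y (t ∷ʳ y)

edgeSum : {A : Set} → (A → ℕ) → A × A → ℕ
edgeSum f (u , v) = f u + f v

zigzag : {A : Set} → A → A → ℕ → List A
zigzag x y zero    = []
zigzag x y (suc j) = x ∷ y ∷ zigzag x y j

module _ {A : Set} where

  length-pathEdges : (a : A) (xs : List A) → length (pathEdges a xs) ≡ length xs
  length-pathEdges a []       = refl
  length-pathEdges a (x ∷ xs) = cong suc (length-pathEdges x xs)

  length-cycleEdges : (y : A) (t : List A) → length (cycleEdges y t) ≡ suc (length t)
  length-cycleEdges y t =
    trans (length-pathEdges y (t ∷ʳ y)) (trans (length-++ t) (+-comm (length t) 1))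

  ∑-edgeSum-pathEdges : (f : A → ℕ) (a : A) (xs : List A) (e : A) →
                        ∑ (edgeSum f) (pathEdges a (xs ∷ʳ e)) ≡ f a + 2 * ∑ f xs + f e
  ∑-edgeSum-pathEdges f a []       e =
    solve 2 (λ a e → (a :+ e) :+ con 0 := a :+ con 2 :* con 0 :+ e) refl (f a) (f e)
  ∑-edgeSum-pathEdges f a (x ∷ xs) e =
    trans (cong (f a + f x +_) (∑-edgeSum-pathEdges f x xs e))
          (solve 4 (λ a x s e → (a :+ x) :+ (x :+ con 2 :* s :+ e) := a :+ con 2 :* (x :+ s) :+ e)
                 refl (f a) (f x) (∑ f xs) (f e))

  ∑-edgeSum-cycleEdges : (f : A → ℕ) (y : A) (t : List A) →
                         ∑ (edgeSum f) (cycleEdges y t) ≡ 2 * ∑ f (y ∷ t)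
  ∑-edgeSum-cycleEdges f y t =
    trans (∑-edgeSum-pathEdges f y t y)
          (solve 2 (λ y s → y :+ con 2 :* s :+ y := con 2 :* (y :+ s)) refl (f y) (∑ f t))

  ∑-zigzag : (f : A → ℕ) (x y : A) (j : ℕ) → ∑ f (zigzag x y j) ≡ j * (f x + f y)
  ∑-zigzag f x y zero    = refl
  ∑-zigzag f x y (suc j) = trans (sym (+-assoc (f x) (f y) _)) (cong (f x + f y +_) (∑-zigzag f x y j))

  length-zigzag : (x y : A) (j : ℕ) → length (zigzag x y j) ≡ 2 * j
  length-zigzag x y zero    = refl
  length-zigzag x y (suc j) = trans (cong (2 +_) (length-zigzag x y j)) (sym (*-suc 2 j))

next-inject₁ : {m : ℕ} (i : Fin m) → next {suc m} (inject₁ i) ≡ suc i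
next-inject₁ {m} i = toℕ-injective (begin
  toℕ (next (inject₁ i))         ≡⟨ toℕ-fromℕ< _ ⟩
  suc (toℕ (inject₁ i)) % suc m ≡⟨ cong (λ j → suc j % suc m) (toℕ-inject₁ i) ⟩
  suc (toℕ i) % suc m           ≡⟨ m<n⇒m%n≡m (s≤s (toℕ<n i)) ⟩
  suc (toℕ i)                   ∎)
  where open ≡-Reasoning

next-fromℕ : (m : ℕ) → next {suc m} (fromℕ m) ≡ zero
next-fromℕ m = toℕ-injective (begin
  toℕ (next (fromℕ m))        ≡⟨ toℕ-fromℕ< _ ⟩
  suc (toℕ (fromℕ m)) % suc m ≡⟨ cong (λ j → suc j % suc m) (toℕ-fromℕ m) ⟩
  suc m % suc m               ≡⟨ n%n≡0 (suc m) ⟩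
  0                           ∎)
  where open ≡-Reasoning

tabulate-∷ʳ : {A : Set} {m : ℕ} (h : Fin (suc m) → A) → tabulate h ≡ tabulate (h ∘ inject₁) ∷ʳ h (fromℕ m)
tabulate-∷ʳ {m = zero}  h = refl
tabulate-∷ʳ {m = suc m} h = cong (h zero ∷_) (tabulate-∷ʳ (h ∘ suc))

module _ {A : Set} where

  pathEdges-tabulate : {m : ℕ} (g : Fin (suc m) → A) (e : A) →
    pathEdges (g zero) (tabulate (g ∘ suc) ∷ʳ e) ≡
    tabulate (λ i → g (inject₁ i) , g (suc i)) ∷ʳ (g (fromℕ m) , e)
  pathEdges-tabulate {zero}  g e = refl
  pathEdges-tabulate {suc m} g e = cong ((g zero , g 1F) ∷_) (pathEdges-tabulate (g ∘ suc) e)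

  cycleEdges-tabulate : {m : ℕ} (f : Fin (suc m) → A) →
    tabulate (λ i → f i , f (next i)) ≡ cycleEdges (f zero) (tabulate (f ∘ suc))
  cycleEdges-tabulate {m} f = begin
    tabulate (λ i → f i , f (next i))
      ≡⟨ tabulate-∷ʳ (λ i → f i , f (next i)) ⟩
    tabulate (λ i → f (inject₁ i) , f (next (inject₁ i))) ∷ʳ (f (fromℕ m) , f (next (fromℕ m)))
      ≡⟨ cong₂ _∷ʳ_ (tabulate-cong (λ i → cong (λ j → f (inject₁ i) , f j) (next-inject₁ i)))
                    (cong (λ j → f (fromℕ m) , f j) (next-fromℕ m)) ⟩
    tabulate (λ i → f (inject₁ i) , f (suc i)) ∷ʳ (f (fromℕ m) , f zero)
      ≡⟨ pathEdges-tabulate f (f zero) ⟨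
    cycleEdges (f zero) (tabulate (f ∘ suc))
      ∎
    where open ≡-Reasoning

module Colouring {A : Set} (_≟_ : DecidableEquality A) where

  monochromatic : A × A → ℕ
  monochromatic (u , v) = χ (u ≟ v)

  centred : A → A → ℕ
  centred z x = χ (z ≟ x)

  crossing : A → A × A → ℕ
  crossing z (u , v) with z ≟ u | z ≟ v
  ... | yes _ | no _  = 1
  ... | no _  | yes _ = 1
  ... | _     | _     = 0

  touching : A → A × A → ℕ
  touching z (u , v) = centred z u ⊔ centred z v

  TwoColoured : A → Set
  TwoColoured z = ∀ x y → z ≢ x → z ≢ y → x ≡ y

  defect : A → A → List A → ℕ
  defect z y t = ∑ (centred z) (y ∷ t) + ∑ monochromatic (cycleEdges y t)

  centred-edge≤1+monochromatic : ∀ z e → edgeSum (centred z) e ≤ 1 + monochromatic e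
  centred-edge≤1+monochromatic z (u , v) with z ≟ u | z ≟ v | u ≟ v
  ... | yes z≡u | yes z≡v | no u≢v = ⊥-elim (u≢v (trans (sym z≡u) z≡v))
  ... | yes _ | yes _ | yes _ = ≤-refl
  ... | yes _ | no _  | _     = s≤s z≤n
  ... | no _  | yes _ | _     = s≤s z≤n
  ... | no _  | no _  | _     = z≤n

  monochromatic+crossing≤1 : ∀ z e → monochromatic e + crossing z e ≤ 1
  monochromatic+crossing≤1 z (u , v) with z ≟ u | z ≟ v | u ≟ v
  ... | yes z≡u | no z≢v | yes u≡v = ⊥-elim (z≢v (trans z≡u u≡v))
  ... | no z≢u | yes z≡v | yes u≡v = ⊥-elim (z≢u (trans z≡v (sym u≡v)))
  ... | yes _ | yes _ | d     = ≤-trans (≤-reflexive (+-identityʳ (χ d))) (χ≤1 d)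
  ... | yes _ | no _  | no _  = ≤-refl
  ... | no _  | yes _ | no _  = ≤-refl
  ... | no _  | no _  | d     = ≤-trans (≤-reflexive (+-identityʳ (χ d))) (χ≤1 d)

  centred-edge+crossing≡2*touching : ∀ z e → edgeSum (centred z) e + crossing z e ≡ 2 * touching z e
  centred-edge+crossing≡2*touching z (u , v) with z ≟ u | z ≟ v
  ... | yes _ | yes _ = refl
  ... | yes _ | no _  = refl
  ... | no _  | yes _ = refl
  ... | no _  | no _  = refl

  crossing≡0⇒centred≡ : ∀ z u v → crossing z (u , v) ≡ 0 → centred z v ≡ centred z u
  crossing≡0⇒centred≡ z u v with z ≟ u | z ≟ v
  ... | yes _ | yes _ = λ _ → refl
  ... | yes _ | no _  = λ ()
  ... | no _  | yes _ = λ ()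
  ... | no _  | no _  = λ _ → refl

  TwoColoured⇒1≤monochromatic+centred-edge : ∀ {z} → TwoColoured z →
    ∀ e → 1 ≤ monochromatic e + edgeSum (centred z) e
  TwoColoured⇒1≤monochromatic+centred-edge {z} two (u , v) with z ≟ u | z ≟ v | u ≟ v
  ... | no z≢u | no z≢v | no u≢v = ⊥-elim (u≢v (two u v z≢u z≢v))
  ... | no _  | no _  | yes _ = s≤s z≤n
  ... | yes _ | _     | d     = ≤-trans (s≤s z≤n) (m≤n+m _ (χ d))
  ... | no _  | yes _ | d     = ≤-trans (s≤s z≤n) (m≤n+m _ (χ d))

  no-crossing⇒constant : ∀ z a xs → ∑ (crossing z) (pathEdges a xs) ≡ 0 →
                          All (λ x → centred z x ≡ centred z a) xs
  no-crossing⇒constant z a []       _  = []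
  no-crossing⇒constant z a (x ∷ xs) eq =
    x∼a ∷ All.map (λ x′∼x → trans x′∼x x∼a) (no-crossing⇒constant z x xs (m+n≡0⇒n≡0 _ eq))
    where x∼a = crossing≡0⇒centred≡ z a x (m+n≡0⇒m≡0 _ eq)

  no-crossing⇒none-or-all-centred : ∀ z y t → ∑ (crossing z) (cycleEdges y t) ≡ 0 →
    ∑ (centred z) (y ∷ t) ≡ 0 ⊎ ∑ (centred z) (y ∷ t) ≡ suc (length t)
  no-crossing⇒none-or-all-centred z y t eq
    with z ≟ y | ∑-All (++⁻ˡ t (no-crossing⇒constant z y (t ∷ʳ y) eq))
  ... | yes _ | ∑t = inj₂ (cong suc (trans ∑t (*-identityʳ (length t))))
  ... | no _  | ∑t = inj₁ (trans ∑t (*-zeroʳ (length t)))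

  module _ (z y : A) (t : List A) where
    private
      E = cycleEdges y t
      T = ∑ (centred z) (y ∷ t)
      M = ∑ monochromatic E
      X = ∑ (crossing z) E

    monochromatic≤length : M ≤ suc (length t)
    monochromatic≤length = subst (M ≤_) (length-cycleEdges y t) (∑≤length (λ e → χ≤1 _) E)

    centred≤length : T ≤ suc (length t)
    centred≤length = ∑≤length (λ x → χ≤1 _) (y ∷ t)

    monochromatic+crossing≤length : M + X ≤ suc (length t)
    monochromatic+crossing≤length = begin
      M + X                                   ≡⟨ ∑-+ monochromatic (crossing z) E ⟨
      ∑ (λ e → monochromatic e + crossing z e) E ≤⟨ ∑≤length (monochromatic+crossing≤1 z) E ⟩
      length E                                ≡⟨ length-cycleEdges y t ⟩
      suc (length t)                          ∎
      where open ≤-Reasoning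

    2*centred+crossing≡2*touching : 2 * T + X ≡ 2 * ∑ (touching z) E
    2*centred+crossing≡2*touching = begin
      2 * T + X                                      ≡⟨ cong (_+ X) (∑-edgeSum-cycleEdges (centred z) y t) ⟨
      ∑ (edgeSum (centred z)) E + X                  ≡⟨ ∑-+ (edgeSum (centred z)) (crossing z) E ⟨
      ∑ (λ e → edgeSum (centred z) e + crossing z e) E ≡⟨ ∑-cong (centred-edge+crossing≡2*touching z) E ⟩
      ∑ (λ e → 2 * touching z e) E                   ≡⟨ ∑-*ˡ 2 (touching z) E ⟩
      2 * ∑ (touching z) E                           ∎
      where open ≡-Reasoning

    crossings≢1 : X ≢ 1
    crossings≢1 X≡1 = even≢odd (∑ (touching z) E) T (begin
      2 * ∑ (touching z) E ≡⟨ 2*centred+crossing≡2*touching ⟨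
      2 * T + X            ≡⟨ cong (2 * T +_) X≡1 ⟩
      2 * T + 1            ≡⟨ +-comm (2 * T) 1 ⟩
      suc (2 * T)          ∎)
      where open ≡-Reasoning

    defect-all-centred : T ≡ suc (length t) → defect z y t ≡ 2 * suc (length t)
    defect-all-centred T≡r = trans (cong₂ _+_ T≡r M≡r) (cong (r +_) (sym (+-identityʳ r)))
      where
      r = suc (length t)
      2r≤r+M : 2 * r ≤ r + M
      2r≤r+M = begin
        2 * r                                        ≡⟨ cong (2 *_) T≡r ⟨
        2 * T                                        ≡⟨ ∑-edgeSum-cycleEdges (centred z) y t ⟨
        ∑ (edgeSum (centred z)) E                    ≤⟨ ∑-mono-≤ (centred-edge≤1+monochromatic z) E ⟩
        ∑ (λ e → 1 + monochromatic e) E              ≡⟨ ∑-+ (λ _ → 1) monochromatic E ⟩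
        ∑ (λ _ → 1) E + M                            ≡⟨ cong (_+ M) (trans (∑-one E) (length-cycleEdges y t)) ⟩
        r + M                                        ∎
        where open ≤-Reasoning
      M≡r : M ≡ r
      M≡r = ≤-antisym monochromatic≤length
              (+-cancelˡ-≤ r r M (subst (_≤ r + M) (cong (r +_) (+-identityʳ r)) 2r≤r+M))

    not-all-centred⇒defect+2<2*length : 2 ≤ length t → T < suc (length t) →
                                         defect z y t + 2 < 2 * suc (length t)
    not-all-centred⇒defect+2<2*length 2≤|t| T<r with X in X≡
    ... | 0 with no-crossing⇒none-or-all-centred z y t X≡
    ...   | inj₂ T≡r = ⊥-elim (<-irrefl T≡r T<r)
    ...   | inj₁ T≡0 = begin-strict
      T + M + 2 ≡⟨ cong (λ s → s + M + 2) T≡0 ⟩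
      M + 2     ≤⟨ +-monoˡ-≤ 2 monochromatic≤length ⟩
      r + 2     <⟨ +-monoʳ-< r (s≤s 2≤|t|) ⟩
      r + r     ≡⟨ cong (r +_) (+-identityʳ r) ⟨
      2 * r     ∎
      where
      open ≤-Reasoning
      r = suc (length t)
    not-all-centred⇒defect+2<2*length 2≤|t| T<r | 1 = ⊥-elim (crossings≢1 X≡)
    not-all-centred⇒defect+2<2*length 2≤|t| T<r | suc (suc x) = begin-strict
      T + M + 2   ≡⟨ +-assoc T M 2 ⟩
      T + (M + 2) <⟨ +-mono-<-≤ T<r M+2≤r ⟩
      r + r       ≡⟨ cong (r +_) (+-identityʳ r) ⟨
      2 * r       ∎
      where
      open ≤-Reasoning
      r = suc (length t)
      M+2≤r : M + 2 ≤ r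
      M+2≤r = ≤-trans (+-monoʳ-≤ M (s≤s (s≤s z≤n)))
                      (subst (λ s → M + s ≤ r) X≡ monochromatic+crossing≤length)

    defect-gap : 2 ≤ length t →
                 defect z y t ≡ 2 * suc (length t) ⊎ defect z y t + 2 < 2 * suc (length t)
    defect-gap 2≤|t| with m≤n⇒m<n∨m≡n centred≤length
    ... | inj₁ T<r = inj₂ (not-all-centred⇒defect+2<2*length 2≤|t| T<r)
    ... | inj₂ T≡r = inj₁ (defect-all-centred T≡r)

    TwoColoured⇒length≤2*defect : TwoColoured z → suc (length t) ≤ 2 * defect z y t
    TwoColoured⇒length≤2*defect two = begin
      suc (length t)                                       ≡⟨ trans (∑-one E) (length-cycleEdges y t) ⟨
      ∑ (λ _ → 1) E                                        ≤⟨ ∑-mono-≤ (TwoColoured⇒1≤monochromatic+centred-edge two) E ⟩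
      ∑ (λ e → monochromatic e + edgeSum (centred z) e) E  ≡⟨ ∑-+ monochromatic (edgeSum (centred z)) E ⟩
      M + ∑ (edgeSum (centred z)) E                        ≡⟨ cong (M +_) (∑-edgeSum-cycleEdges (centred z) y t) ⟩
      M + 2 * T                                            ≤⟨ m≤m+n (M + 2 * T) M ⟩
      M + 2 * T + M                                        ≡⟨ solve 2 (λ T M → M :+ con 2 :* T :+ M := con 2 :* (T :+ M)) refl T M ⟩
      2 * (T + M)                                          ∎
      where open ≤-Reasoning

  ∑-monochromatic-replicate : ∀ x m xs →
    ∑ monochromatic (pathEdges x (replicate m x ++ xs)) ≡ m + ∑ monochromatic (pathEdges x xs)
  ∑-monochromatic-replicate x zero    xs = refl
  ∑-monochromatic-replicate x (suc m) xs =
    cong₂ _+_ (χ-yes refl (x ≟ x)) (∑-monochromatic-replicate x m xs)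

  ∑-monochromatic-zigzag : ∀ {x y} → x ≢ y → ∀ j xs →
    ∑ monochromatic (pathEdges y (zigzag x y j ++ xs)) ≡ ∑ monochromatic (pathEdges y xs)
  ∑-monochromatic-zigzag         x≢y zero    xs = refl
  ∑-monochromatic-zigzag {x} {y} x≢y (suc j) xs =
    trans (cong₂ (λ a b → a + (b + ∑ monochromatic (pathEdges y (zigzag x y j ++ xs)))) (χ-no (x≢y ∘ sym) (y ≟ x)) (χ-no x≢y (x ≟ y)))
          (∑-monochromatic-zigzag x≢y j xs)

module FinColouring {ℓ : ℕ} = Colouring (Fin._≟_ {ℓ})
open FinColouring

badCount-wheel : {ℓ m : ℕ} (c : Fin (2 + m) → Fin ℓ) →
  badCount (wheel (2 + m)) c ≡ defect (c zero) (c 1F) (tabulate (λ i → c (suc (suc i))))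
badCount-wheel {m = m} c = begin
  badCount (wheel (2 + m)) c
    ≡⟨ length-filter≡∑χ _ (spokes ++ rim) ⟩
  ∑ bad (spokes ++ rim)
    ≡⟨ ∑-++ bad spokes rim ⟩
  ∑ bad spokes + ∑ bad rim
    ≡⟨ cong₂ _+_ (trans (∑-map bad spoke (allFin _)) (sym (∑-map (centred (c zero)) (c ∘ suc) (allFin _))))
                 (trans (∑-map bad rimEdge (allFin _)) (sym (∑-map monochromatic rimColours (allFin _)))) ⟩
  ∑ (centred (c zero)) (map (c ∘ suc) (allFin _)) + ∑ monochromatic (map rimColours (allFin _))
    ≡⟨ cong₂ _+_ (cong (∑ (centred (c zero))) (map-tabulate id (c ∘ suc)))
                 (cong (∑ monochromatic) (trans (map-tabulate id rimColours) (cycleEdges-tabulate (c ∘ suc)))) ⟩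
  defect (c zero) (c 1F) (tabulate (λ i → c (suc (suc i))))
    ∎
  where
  open ≡-Reasoning
  spoke rimEdge : Fin (suc m) → Fin (2 + m) × Fin (2 + m)
  spoke i   = zero , suc i
  rimEdge i = suc i , suc (next i)
  spokes = map spoke (allFin (suc m))
  rim    = map rimEdge (allFin (suc m))
  bad : Fin (2 + m) × Fin (2 + m) → ℕ
  bad (u , v) = χ (c u Fin.≟ c v)
  rimColours : Fin (suc m) → _
  rimColours i = c (suc i) , c (suc (next i))

wheel-colouring : {ℓ : ℕ} (z y : Fin ℓ) (t : List (Fin ℓ)) →
                  HasDefect (wheel (2 + length t)) ℓ (defect z y t)
wheel-colouring {ℓ} z y t = colour , trans (badCount-wheel {m = length t} colour) (cong (defect z y) (tabulate-lookup t))
  where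
  colour : Fin (2 + length t) → Fin ℓ
  colour zero    = z
  colour (suc i) = lookup (y ∷ t) i

fin≤2-TwoColoured : {ℓ : ℕ} → ℓ ≤ 2 → (z : Fin ℓ) → TwoColoured z
fin≤2-TwoColoured _                 zero    zero    _       z≢x _   = ⊥-elim (z≢x refl)
fin≤2-TwoColoured _                 zero    (suc _) zero    _   z≢y = ⊥-elim (z≢y refl)
fin≤2-TwoColoured (s≤s (s≤s z≤n))   zero    1F      1F      _   _   = refl
fin≤2-TwoColoured _                 (suc _) zero    zero    _   _   = refl
fin≤2-TwoColoured (s≤s (s≤s z≤n))   1F      1F      _       z≢x _   = ⊥-elim (z≢x refl)
fin≤2-TwoColoured (s≤s (s≤s z≤n))   1F      zero    1F      _   z≢y = ⊥-elim (z≢y refl)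

module _ {ℓ m : ℕ} (c : Fin (2 + m) → Fin ℓ) where
  private
    rimTail = tabulate (λ i → c (suc (suc i)))
    D = defect (c zero) (c 1F) rimTail
    |rimTail| : length rimTail ≡ m
    |rimTail| = length-tabulate _

  wheel-gap : 2 ≤ m → badCount (wheel (2 + m)) c ≡ 2 * suc m
                    ⊎ badCount (wheel (2 + m)) c + 2 < 2 * suc m
  wheel-gap 2≤m rewrite badCount-wheel c =
    subst (λ l → D ≡ 2 * suc l ⊎ D + 2 < 2 * suc l) |rimTail|
          (defect-gap (c zero) (c 1F) rimTail (subst (2 ≤_) (sym |rimTail|) 2≤m))

  wheel-fin≤2 : ℓ ≤ 2 → suc m ≤ 2 * badCount (wheel (2 + m)) c
  wheel-fin≤2 ℓ≤2 rewrite badCount-wheel c =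
    subst (λ l → suc l ≤ 2 * D) |rimTail|
          (TwoColoured⇒length≤2*defect (c zero) (c 1F) rimTail (fin≤2-TwoColoured ℓ≤2 (c zero)))

wheel-one-colour : {m : ℕ} (c : Fin (2 + m) → Fin 1) → badCount (wheel (2 + m)) c ≡ 2 * suc m
wheel-one-colour c rewrite badCount-wheel c =
  subst (λ l → defect (c zero) (c 1F) rimTail ≡ 2 * suc l) (length-tabulate _)
        (defect-all-centred (c zero) (c 1F) rimTail
          (trans (∑-cong (λ x → χ-yes (Fin1-equal (c zero) x) (c zero Fin.≟ x)) (c 1F ∷ rimTail))
                 (∑-one (c 1F ∷ rimTail))))
  where
  rimTail = tabulate (λ i → c (suc (suc i)))
  Fin1-equal : (a b : Fin 1) → a ≡ b
  Fin1-equal zero zero = refl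

two-colour-family : ∀ a b j → HasDefect (wheel (a + b + 2 * j + 3)) 2 (2 * a + b + j + 1)
two-colour-family a b j = subst₂ (λ n k → HasDefect (wheel n) 2 k) size value (wheel-colouring 0F 0F t)
  where
  t = replicate a 0F ++ 1F ∷ replicate b 1F ++ zigzag 0F 1F j

  size : 2 + length t ≡ a + b + 2 * j + 3
  size = trans (cong (2 +_) (trans (length-++ (replicate a 0F))
                 (cong₂ _+_ (length-replicate a)
                   (cong suc (trans (length-++ (replicate b 1F))
                     (cong₂ _+_ (length-replicate b) (length-zigzag 0F 1F j)))))))
               (solve 3 (λ a b j → con 2 :+ (a :+ (con 1 :+ (b :+ con 2 :* j))) := a :+ b :+ con 2 :* j :+ con 3)
                      refl a b j)

  centred-t : ∑ (centred 0F) t ≡ a * 1 + (b * 0 + j * 1)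
  centred-t = trans (∑-++ (centred 0F) (replicate a 0F) _)
                (cong₂ _+_ (∑-replicate (centred 0F) a 0F)
                  (trans (∑-++ (centred 0F) (replicate b 1F) _)
                    (cong₂ _+_ (∑-replicate (centred 0F) b 1F) (∑-zigzag (centred 0F) 0F 1F j))))

  monochromatic-t : ∑ monochromatic (cycleEdges 0F t) ≡ a + (b + 0)
  monochromatic-t = begin
    ∑ monochromatic (pathEdges 0F (t ∷ʳ 0F))
      ≡⟨ cong (∑ monochromatic ∘ pathEdges 0F)
              (trans (++-assoc (replicate a 0F) _ _)
                     (cong (λ l → replicate a 0F ++ 1F ∷ l) (++-assoc (replicate b 1F) _ _))) ⟩
    ∑ monochromatic (pathEdges 0F (replicate a 0F ++ 1F ∷ replicate b 1F ++ zigzag 0F 1F j ++ 0F ∷ []))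
      ≡⟨ ∑-monochromatic-replicate 0F a _ ⟩
    a + ∑ monochromatic (pathEdges 1F (replicate b 1F ++ zigzag 0F 1F j ++ 0F ∷ []))
      ≡⟨ cong (a +_) (∑-monochromatic-replicate 1F b _) ⟩
    a + (b + ∑ monochromatic (pathEdges 1F (zigzag 0F 1F j ++ 0F ∷ [])))
      ≡⟨ cong (λ s → a + (b + s)) (∑-monochromatic-zigzag (λ ()) j _) ⟩
    a + (b + 0)
      ∎
    where open ≡-Reasoning

  value : defect 0F 0F t ≡ 2 * a + b + j + 1
  value = trans (cong₂ (λ s m → suc s + m) centred-t monochromatic-t)
                (solve 3 (λ a b j → con 1 :+ (a :* con 1 :+ (b :* con 0 :+ j :* con 1)) :+ (a :+ (b :+ con 0))
                                    := con 2 :* a :+ b :+ j :+ con 1)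
                       refl a b j)

three-colour-family : ∀ a j (x : Fin 3) → x ≢ 1F →
                      HasDefect (wheel (a + 2 * j + 3)) 3 (a + centred 0F x)
three-colour-family a j x x≢1 = subst₂ (λ n k → HasDefect (wheel n) 3 k) size value (wheel-colouring 0F 1F t)
  where
  t = replicate a 1F ++ zigzag 2F 1F j ++ x ∷ []

  size : 2 + length t ≡ a + 2 * j + 3
  size = trans (cong (2 +_) (trans (length-++ (replicate a 1F))
                 (cong₂ _+_ (length-replicate a)
                   (trans (length-++ (zigzag 2F 1F j)) (cong (_+ 1) (length-zigzag 2F 1F j))))))
               (solve 2 (λ a j → con 2 :+ (a :+ (con 2 :* j :+ con 1)) := a :+ con 2 :* j :+ con 3) refl a j)

  centred-t : ∑ (centred 0F) t ≡ a * 0 + (j * 0 + (centred 0F x + 0))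
  centred-t = trans (∑-++ (centred 0F) (replicate a 1F) _)
                (cong₂ _+_ (∑-replicate (centred 0F) a 1F)
                  (trans (∑-++ (centred 0F) (zigzag 2F 1F j) _)
                    (cong (_+ (centred 0F x + 0)) (∑-zigzag (centred 0F) 2F 1F j))))

  monochromatic-t : ∑ monochromatic (cycleEdges 1F t) ≡ a + 0
  monochromatic-t = begin
    ∑ monochromatic (pathEdges 1F (t ∷ʳ 1F))
      ≡⟨ cong (∑ monochromatic ∘ pathEdges 1F)
              (trans (++-assoc (replicate a 1F) _ _) (cong (replicate a 1F ++_) (++-assoc (zigzag 2F 1F j) _ _))) ⟩
    ∑ monochromatic (pathEdges 1F (replicate a 1F ++ zigzag 2F 1F j ++ x ∷ 1F ∷ []))
      ≡⟨ ∑-monochromatic-replicate 1F a _ ⟩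
    a + ∑ monochromatic (pathEdges 1F (zigzag 2F 1F j ++ x ∷ 1F ∷ []))
      ≡⟨ cong (a +_) (∑-monochromatic-zigzag (λ ()) j _) ⟩
    a + (χ (1F Fin.≟ x) + (χ (x Fin.≟ 1F) + 0))
      ≡⟨ cong (a +_) (cong₂ (λ u v → u + (v + 0)) (χ-no (x≢1 ∘ sym) (1F Fin.≟ x)) (χ-no x≢1 (x Fin.≟ 1F))) ⟩
    a + 0
      ∎
    where open ≡-Reasoning

  value : defect 0F 1F t ≡ a + centred 0F x
  value = trans (cong₂ _+_ centred-t monochromatic-t)
                (solve 3 (λ a j c → (a :* con 0 :+ (j :* con 0 :+ (c :+ con 0))) :+ (a :+ con 0) := a :+ c)
                       refl a j (centred 0F x))

even-or-odd : ∀ n → n ≡ 2 * (n / 2) ⊎ n ≡ suc (2 * (n / 2))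
even-or-odd n with n % 2 | m≡m%n+[m/n]*n n 2 | m%n<n n 2
... | 0           | n≡ | _ = inj₁ (trans n≡ (*-comm (n / 2) 2))
... | 1           | n≡ | _ = inj₂ (trans n≡ (cong suc (*-comm (n / 2) 2)))
... | suc (suc _) | _  | s≤s (s≤s ())

2*[n/2]≤n : ∀ n → 2 * (n / 2) ≤ n
2*[n/2]≤n n with even-or-odd n
... | inj₁ n≡ = ≤-reflexive (sym n≡)
... | inj₂ n≡ = ≤-trans (n≤1+n _) (≤-reflexive (sym n≡))

n≤1+2*[n/2] : ∀ n → n ≤ suc (2 * (n / 2))
n≤1+2*[n/2] n with even-or-odd n
... | inj₁ n≡ = ≤-trans (≤-reflexive n≡) (n≤1+n _)
... | inj₂ n≡ = ≤-reflexive n≡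

wheel-two-colours : ∀ r k → r ≤ 2 * k → k + 3 ≤ 2 * r → HasDefect (wheel (suc r)) 2 k
wheel-two-colours r k r≤2k k+3≤2r with <-≤-connex k r
... | inj₁ k<r =
  let d , k+1+d≡r = m≤n⇒∃[o]m+o≡n k<r
      b , d+1+b≡k = m≤n⇒∃[o]m+o≡n (+-cancelˡ-≤ k (suc d) k (begin
        k + suc d ≡⟨ +-suc k d ⟩
        suc k + d ≡⟨ k+1+d≡r ⟩
        r         ≤⟨ r≤2k ⟩
        2 * k     ≡⟨ cong (k +_) (+-identityʳ k) ⟩
        k + k     ∎))
  in subst₂ (λ n k → HasDefect (wheel n) 2 k)
       (trans (solve 2 (λ b d → con 0 :+ b :+ con 2 :* d :+ con 3 := con 2 :+ (con 1 :+ d :+ b) :+ d) refl b d)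
              (cong suc (trans (cong (λ k → suc k + d) d+1+b≡k) k+1+d≡r)))
       (trans (solve 2 (λ b d → con 2 :* con 0 :+ b :+ d :+ con 1 := con 1 :+ d :+ b) refl b d) d+1+b≡k)
       (two-colour-family 0 b d)
  where open ≤-Reasoning
... | inj₂ r≤k =
  let e , r+e≡k = m≤n⇒∃[o]m+o≡n r≤k
      b , e+3+b≡r = m≤n⇒∃[o]m+o≡n (+-cancelˡ-≤ r (e + 3) r (begin
        r + (e + 3) ≡⟨ +-assoc r e 3 ⟨
        r + e + 3   ≡⟨ cong (_+ 3) r+e≡k ⟩
        k + 3       ≤⟨ k+3≤2r ⟩
        2 * r       ≡⟨ cong (r +_) (+-identityʳ r) ⟩
        r + r       ∎))
  in subst₂ (λ n k → HasDefect (wheel n) 2 k)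
       (trans (solve 2 (λ e b → con 1 :+ e :+ b :+ con 2 :* con 0 :+ con 3 := con 1 :+ (e :+ con 3 :+ b)) refl e b)
              (cong suc e+3+b≡r))
       (trans (solve 2 (λ e b → con 2 :* (con 1 :+ e) :+ b :+ con 0 :+ con 1 := (e :+ con 3 :+ b) :+ e) refl e b)
              (trans (cong (_+ e) e+3+b≡r) r+e≡k))
       (two-colour-family (suc e) b 0)
  where open ≤-Reasoning

wheel-three-colours : ∀ r k → 1 ≤ k → 2 * k < r → HasDefect (wheel (suc r)) 3 k
wheel-three-colours r (suc k) _ 2k<r with m≤n⇒∃[o]m+o≡n 2k<r
... | d , 2k+1+d≡r with even-or-odd (k + d)
...   | inj₁ k+d≡2j = subst₂ (λ n k → HasDefect (wheel n) 3 k)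
          (trans (cong (λ s → suc k + s + 3) (sym k+d≡2j))
                 (trans (solve 2 (λ k d → con 1 :+ k :+ (k :+ d) :+ con 3 := con 1 :+ (con 1 :+ con 2 :* (con 1 :+ k) :+ d)) refl k d)
                        (cong suc 2k+1+d≡r)))
          (+-identityʳ (suc k))
          (three-colour-family (suc k) ((k + d) / 2) 2F (λ ()))
...   | inj₂ k+d≡2j+1 = subst₂ (λ n k → HasDefect (wheel n) 3 k)
          (trans (cong (λ s → k + s + 3) (trans (*-suc 2 ((k + d) / 2)) (cong suc (sym k+d≡2j+1))))
                 (trans (solve 2 (λ k d → k :+ (con 1 :+ (k :+ d)) :+ con 3 := con 1 :+ (con 1 :+ con 2 :* (con 1 :+ k) :+ d)) refl k d)
                        (cong suc 2k+1+d≡r)))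
          (+-comm k 1)
          (three-colour-family k (suc ((k + d) / 2)) 0F (λ ()))

mainTheorem4 : (n k : ℕ) → 3 < n → 1 ≤ k → k ≤ 2 * n ∸ 2 →
    ((2 * n ∸ 4 ≤ k → k ≤ 2 * n ∸ 3 → PhiIs (wheel n) k 0)
    × (k ≡ 2 * n ∸ 2 → PhiIs (wheel n) k 1)
    × (n / 2 ≤ k → k ≤ 2 * n ∸ 5 → PhiIs (wheel n) k 2)
    × (k < n / 2 → PhiIs (wheel n) k 3))
mainTheorem4 n@(suc r@(suc m@(suc (suc _)))) k (s≤s (s≤s (s≤s (s≤s _)))) 1≤k _ =
  no-colouring , one-colour , two-colours , three-colours
  where
  2n≡2+2r : 2 * n ≡ 2 + 2 * r
  2n≡2+2r = *-suc 2 r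

  no-colouring : 2 * n ∸ 4 ≤ k → k ≤ 2 * n ∸ 3 → PhiIs (wheel n) k 0
  no-colouring lo hi _ (c , bad≡k) with wheel-gap c (s≤s (s≤s z≤n))
  ... | inj₁ bad≡2r = 1+n≰n (subst (_≤ 2 * r ∸ 1) (trans (sym bad≡k) bad≡2r) (subst (λ x → k ≤ x ∸ 3) 2n≡2+2r hi))
  ... | inj₂ bad+2<2r = 1+n≰n (≤-trans (m+n≤o⇒m≤o∸n (suc k) (subst (λ x → x + 2 < 2 * r) bad≡k bad+2<2r))
                                      (subst (λ x → x ∸ 4 ≤ k) 2n≡2+2r lo))

  one-colour : k ≡ 2 * n ∸ 2 → PhiIs (wheel n) k 1
  one-colour k≡ = ((λ _ → zero) , trans (wheel-one-colour {m = m} (λ _ → zero)) (sym (trans k≡ (cong (_∸ 2) 2n≡2+2r))))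
                , λ _ 1≤ℓ ℓ<1 _ → ≤⇒≯ 1≤ℓ ℓ<1

  two-colours : n / 2 ≤ k → k ≤ 2 * n ∸ 5 → PhiIs (wheel n) k 2
  two-colours lo hi = wheel-two-colours r k (s≤s⁻¹ (≤-trans (n≤1+2*[n/2] n) (s≤s (*-monoʳ-≤ 2 lo)))) k+3≤2r
                    , λ { 1 _ _ (c , bad≡k) → m+1+n≰m (2 * r) (subst (λ x → x + 3 ≤ 2 * r) (trans (sym bad≡k) (wheel-one-colour c)) k+3≤2r)
                        ; (suc (suc _)) _ (s≤s (s≤s ())) }
    where
    k+3≤2r : k + 3 ≤ 2 * r
    k+3≤2r = m≤o∸n⇒m+n≤o k (s≤s (s≤s (s≤s z≤n))) (subst (λ x → k ≤ x ∸ 5) 2n≡2+2r hi)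

  three-colours : k < n / 2 → PhiIs (wheel n) k 3
  three-colours hi = wheel-three-colours r k 1≤k 2k<r
                   , λ _ _ ℓ<3 (c , bad≡k) → <⇒≱ 2k<r (subst (λ x → r ≤ 2 * x) bad≡k (wheel-fin≤2 c (s≤s⁻¹ ℓ<3)))
    where
    2k<r : 2 * k < r
    2k<r = s≤s⁻¹ (subst (_≤ n) (*-suc 2 k) (≤-trans (*-monoʳ-≤ 2 hi) (2*[n/2]≤n n)))
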